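{- Let $n\geqslant1$, let $v$ be an odd positive divisor of $n$, and $l=n/v$. Let $H\subseteq\{0,1,\dots,v-1\}\subseteq\mathbb{Z}_n$ with $0\in H$, and $X,Y\subseteq\mathbb{Z}_n$ satisfy: (i) $Y=H+v\mathbb{Z}_n$ and $X=Y\setminus\{0\}$; (ii) $Y\uplus(-Y)=\mathbb{Z}_n\uplus v\mathbb{Z}_n$ as multisets. Then $Dih(n,X,Y)$ is a DSRG with parameters $\left(2n,\,n+l-1,\,\frac{n+l}{2},\,\frac{n+3l}{2}-2,\,\frac{n+3l}{2}-1\right)$.
   Context: $D_n=\langle x,a\mid x^n=1,\ a^2=1,\ ax=x^{ -1}a\rangle$; $Dih(n,X,Y)$ is the Cayley digraph on $D_n$ with connection set $\{x^i:i\in X\}\cup\{x^ja:j\in Y\}$. A DSRG with parameters $(N,k,\mu,\lambda,t)$: adjacency matrix $A$ with $AJ=JA=kJ$ and $A^2=tI+\lambda A+\mu(J-I-A)$. $v\mathbb{Z}_n$ is the subgroup of multiples of $v$; $\uplus$ is multiset union. -}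

module Defs where

open import Data.Bool using (Bool; true; false; if_then_else_; _∧_; _xor_; not)
open import Data.Nat using (ℕ; zero; suc; _+_; _*_; _∸_; NonZero)
open import Data.Nat.DivMod using (_mod_)
open import Data.Fin using (Fin; toℕ; remQuot; _≟_) renaming (zero to fzero; suc to fsuc)
open import Data.Fin.Subset using (Subset)
open import Data.Vec using (lookup)
open import Data.Product using (_×_; _,_)
open import Relation.Nullary using (does)
open import Relation.Binary.PropositionalEquality using (_≡_)

χ : Bool → ℕ
χ true  = 1
χ false = 0

count : ∀ {N} → (Fin N → Bool) → ℕ
count {zero}  f = 0
count {suc N} f = χ (f fzero) + count (λ i → f (fsuc i))

-- Directed strongly regular graph with parameters (N, k, μ, λ, t),
-- given by its 0/1 adjacency matrix A on vertex set Fin N: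
--   AJ = JA = kJ   (all row and column sums equal k)
--   A² = tI + λA + μ(J − I − A), entrywise; the (u,w) entry is
--   t·δ + λ·a + μ·(1 − δ − a) with δ = [u = w], a = A u w; it is written
--   here with the μ(δ + a) term moved to the left side (so it is an
--   equation in ℕ equivalent to the integer one).
record IsDSRG (N : ℕ) (A : Fin N → Fin N → Bool) (k μ λ' t : ℕ) : Set where
  field
    rowSum : ∀ u → count (λ w → A u w) ≡ k
    colSum : ∀ w → count (λ u → A u w) ≡ k
    square : ∀ u w →
      count (λ z → A u z ∧ A z w) + μ * (χ (does (u ≟ w)) + χ (A u w))
        ≡ t * χ (does (u ≟ w)) + λ' * χ (A u w) + μ

module _ {n : ℕ} .{{_ : NonZero n}} where

  ι : ℕ → Fin n
  ι m = m mod n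

  _⊕_ : Fin n → Fin n → Fin n
  i ⊕ j = ι (toℕ i + toℕ j)

  ⊖_ : Fin n → Fin n
  ⊖ i = ι (n ∸ toℕ i)

-- Elements of D_n: (r , i) stands for x^i a^r  (r = true means the factor a).
Dn : ℕ → Set
Dn n = Bool × Fin n

module _ {n : ℕ} .{{_ : NonZero n}} where

  -- (x^i a^r)(x^j a^s) = x^(i + (-1)^r j) a^(r xor s)   (using a x = x⁻¹ a)
  _·_ : Dn n → Dn n → Dn n
  (r , i) · (s , j) = (r xor s , i ⊕ (if r then ⊖ j else j))

  inv : Dn n → Dn n
  inv (false , i) = (false , ⊖ i)
  inv (true  , i) = (true  , i)

  inS : Subset n → Subset n → Dn n → Bool
  inS X Y (false , i) = lookup X i
  inS X Y (true  , j) = lookup Y j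

  -- Cayley digraph Dih(n,X,Y): arc g → h iff g⁻¹h ∈ S.
  -- Vertex set D_n is identified with Fin (2 * n) via the bijection remQuot.
  Dih : Subset n → Subset n → Fin (2 * n) → Fin (2 * n) → Bool
  Dih X Y g h = inS X Y (inv (dec g) · dec h)
    where
      toB : Fin 2 → Bool
      toB fzero = false
      toB (fsuc _) = true
      dec : Fin (2 * n) → Dn n
      dec e with remQuot {2} n e
      ... | (b , i) = (toB b , i)

-- Dih(n,X,Y) is the Cayley digraph of D_n with connection set S = {x^i : i ∈ X} ∪ {x^j a : j ∈ Y},
-- so it is a DSRG with k = |S| as soon as the number of factorisations g = s s′ with s, s′ ∈ S is
-- t, λ or μ according as g = e, g ∈ S or neither. For g = x^m and g = x^m a these numbers are,
-- up to the contributions of 0 ∈ Y ∖ X, the counts #{c ∈ Y : m − c ∈ Y} and #{c ∈ Y : c − m ∈ Y},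
-- whose sum is |Y| + [m ∈ Y]·l: by (ii) the indicators of m − c ∈ Y and c − m ∈ Y add up to
-- 1 + [v ∣ c − m], and as Y is a union of cosets of vℤ_n, c ∈ Y may be replaced by m ∈ Y
-- whenever v ∣ c − m. Summing (ii) over ℤ_n gives 2|Y| = n + l, which fixes μ = |Y|.

module Submission where

open import Defs
open import Algebra.Bundles using (AbelianGroup; Group)
open import Algebra.Core using (Op₁; Op₂)
open import Algebra.Structures using (IsAbelianGroup; IsGroup)
import Algebra.Properties.AbelianGroup as AbelianGroupProperties
import Algebra.Properties.Group as GroupProperties
open import Data.Bool using (Bool; true; false; _∧_; _xor_; if_then_else_)
import Data.Bool as Bool
open import Data.Bool.Properties
  using (∧-comm; ∧-identityʳ; ∧-zeroʳ; xor-assoc; xor-identityʳ; ⇔→≡; ¬-not)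
open import Data.Fin using (Fin; toℕ; splitAt; _↑ˡ_; _↑ʳ_) renaming (zero to fzero; suc to fsuc)
import Data.Fin as Fin
open import Data.Fin.Properties using (toℕ-fromℕ<; toℕ-injective; toℕ<n; toℕ-↑ˡ; toℕ-↑ʳ; *↔×; 2↔Bool)
open import Data.Fin.Subset using (Subset)
open import Data.Vec using (lookup)
open import Data.Nat
  using (ℕ; zero; suc; pred; _+_; _*_; _∸_; _<_; NonZero; ≢-nonZero; ≢-nonZero⁻¹; >-nonZero⁻¹)
open import Data.Nat.DivMod using (_%_; m%n<n; m<n⇒m%n≡m; %-distribˡ-+; n%n≡0)
open import Data.Nat.Divisibility
  using (_∣_; _∣?_; divides; ∣⇒≤; %-presˡ-∣; ∣-refl; ∣m+n∣m⇒∣n; ∣m∣n⇒∣m+n)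
open import Data.Nat.Properties
  using (+-0-commutativeMonoid; +-comm; +-assoc; +-identityʳ; +-suc; *-comm; *-identityˡ; *-identityʳ;
         *-zeroʳ; *-distribˡ-+; +-cancelʳ-≡; m∸n+n≡m; m+[n∸m]≡n; <⇒≤; <-irrefl; ≤-trans; suc-pred)
open import Algebra.Properties.CommutativeMonoid.Sum +-0-commutativeMonoid
  using (sum; sum-cong-≗; ∑-distrib-+; sum-permute)
open import Data.Nat.Tactic.RingSolver using (solve-∀)
open import Data.Product using (Σ; ∃-syntax; _×_; _,_; proj₁; proj₂)
open import Data.Product.Function.NonDependent.Propositional using (_×-↔_)
open import Data.Product.Properties using (≡-dec)
open import Data.Sum using (inj₁; inj₂)
open import Function using (_∘_; _⇔_; _↔_; Inverse; Equivalence; mk⇔; mk↔ₛ′)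
open import Function.Construct.Composition using (_↔-∘_)
open import Function.Construct.Identity using (↔-id)
open import Function.Construct.Symmetry using (↔-sym)
open import Relation.Binary.Definitions using (DecidableEquality)
open import Relation.Binary.PropositionalEquality
open import Relation.Nullary using (¬_; does; yes; no)
open import Relation.Nullary.Decidable using (dec-false; does-⇔)

χ-∧ : ∀ a b → χ (a ∧ b) ≡ χ a * χ b
χ-∧ false b = refl
χ-∧ true  b = sym (*-identityˡ (χ b))

count≡∑ : ∀ {N} (f : Fin N → Bool) → count f ≡ sum (χ ∘ f)
count≡∑ {zero}  f = refl
count≡∑ {suc N} f = cong (χ (f fzero) +_) (count≡∑ (f ∘ fsuc))

count-cong : ∀ {N} {f g : Fin N → Bool} → f ≗ g → count f ≡ count g
count-cong {zero}  f≗g = refl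
count-cong {suc N} f≗g = cong₂ _+_ (cong χ (f≗g fzero)) (count-cong (f≗g ∘ fsuc))

count-+ : ∀ {N} {f g h : Fin N → Bool} →
          (∀ i → χ (f i) ≡ χ (g i) + χ (h i)) → count f ≡ count g + count h
count-+ {f = f} {g} {h} χf≡χg+χh = begin
  count f                      ≡⟨ count≡∑ f ⟩
  sum (χ ∘ f)                  ≡⟨ sum-cong-≗ χf≡χg+χh ⟩
  sum (λ i → χ (g i) + χ (h i)) ≡⟨ ∑-distrib-+ (χ ∘ g) (χ ∘ h) ⟩
  sum (χ ∘ g) + sum (χ ∘ h)    ≡⟨ cong₂ _+_ (count≡∑ g) (count≡∑ h) ⟨
  count g + count h            ∎
  where open ≡-Reasoning

count-+-cong : ∀ {N} {f g h k : Fin N → Bool} →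
               (∀ i → χ (f i) + χ (g i) ≡ χ (h i) + χ (k i)) →
               count f + count g ≡ count h + count k
count-+-cong {f = f} {g} {h} {k} pointwise = begin
  count f + count g             ≡⟨ cong₂ _+_ (count≡∑ f) (count≡∑ g) ⟩
  sum (χ ∘ f) + sum (χ ∘ g)     ≡⟨ ∑-distrib-+ (χ ∘ f) (χ ∘ g) ⟨
  sum (λ i → χ (f i) + χ (g i)) ≡⟨ sum-cong-≗ pointwise ⟩
  sum (λ i → χ (h i) + χ (k i)) ≡⟨ ∑-distrib-+ (χ ∘ h) (χ ∘ k) ⟩
  sum (χ ∘ h) + sum (χ ∘ k)     ≡⟨ cong₂ _+_ (count≡∑ h) (count≡∑ k) ⟨
  count h + count k             ∎
  where open ≡-Reasoning

count-const-∧ : ∀ {N} b (f : Fin N → Bool) → count (λ i → b ∧ f i) ≡ χ b * count f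
count-const-∧ {zero}  b f = sym (*-zeroʳ (χ b))
count-const-∧ {suc N} b f = begin
  χ (b ∧ f fzero) + count (λ i → b ∧ f (fsuc i))
    ≡⟨ cong₂ _+_ (χ-∧ b (f fzero)) (count-const-∧ b (f ∘ fsuc)) ⟩
  χ b * χ (f fzero) + χ b * count (f ∘ fsuc)
    ≡⟨ *-distribˡ-+ (χ b) _ _ ⟨
  χ b * count f
    ∎
  where open ≡-Reasoning

count-point : ∀ {N} (a : Fin N) (P : Fin N → Bool) → count (λ c → does (c Fin.≟ a) ∧ P c) ≡ χ (P a)
count-point fzero    P = trans (cong (χ (P fzero) +_) (count-const-∧ false (P ∘ fsuc))) (+-identityʳ _)
count-point (fsuc a) P = count-point a (P ∘ fsuc)

count-≟ : ∀ {N} (a : Fin N) → count (λ c → does (c Fin.≟ a)) ≡ 1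
count-≟ a = trans (count-cong (λ c → sym (∧-identityʳ (does (c Fin.≟ a))))) (count-point a (λ _ → true))

count-true : ∀ N → count {N} (λ _ → true) ≡ N
count-true zero    = refl
count-true (suc N) = cong suc (count-true N)

count-splitAt : ∀ m {k} (f : Fin (m + k) → Bool) →
                count f ≡ count (λ i → f (i ↑ˡ k)) + count (λ i → f (m ↑ʳ i))
count-splitAt zero    f = refl
count-splitAt (suc m) f = trans (cong (χ (f fzero) +_) (count-splitAt m (f ∘ fsuc)))
                                (sym (+-assoc (χ (f fzero)) _ _))

count-permute : ∀ {N} (f : Fin N → Bool) (π : Fin N ↔ Fin N) → count f ≡ count (f ∘ Inverse.to π)
count-permute f π = trans (count≡∑ f) (trans (sum-permute (χ ∘ f) π) (sym (count≡∑ (f ∘ Inverse.to π))))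

count-adjoinʳ : ∀ {N} {f g : Fin N → Bool} (a : Fin N) →
                (∀ c → χ (f c) ≡ χ (g c) + χ (does (c Fin.≟ a))) →
                ∀ P → count (λ c → P c ∧ f c) ≡ count (λ c → P c ∧ g c) + χ (P a)
count-adjoinʳ {f = f} {g} a f≡g+a P =
  trans (count-+ pointwise) (cong (count (λ c → P c ∧ g c) +_) (count-point a P))
  where
  open ≡-Reasoning
  pointwise : ∀ c → χ (P c ∧ f c) ≡ χ (P c ∧ g c) + χ (does (c Fin.≟ a) ∧ P c)
  pointwise c = begin
    χ (P c ∧ f c)                                  ≡⟨ χ-∧ (P c) (f c) ⟩
    χ (P c) * χ (f c)                              ≡⟨ cong (χ (P c) *_) (f≡g+a c) ⟩
    χ (P c) * (χ (g c) + χ (does (c Fin.≟ a)))     ≡⟨ *-distribˡ-+ (χ (P c)) _ _ ⟩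
    χ (P c) * χ (g c) + χ (P c) * χ (does (c Fin.≟ a))
      ≡⟨ cong₂ _+_ (χ-∧ (P c) (g c)) (trans (cong χ (∧-comm _ (P c))) (χ-∧ (P c) _)) ⟨
    χ (P c ∧ g c) + χ (does (c Fin.≟ a) ∧ P c)     ∎

count-adjoinˡ : ∀ {N} {f g : Fin N → Bool} (a : Fin N) →
                (∀ c → χ (f c) ≡ χ (g c) + χ (does (c Fin.≟ a))) →
                ∀ P → count (λ c → f c ∧ P c) ≡ count (λ c → g c ∧ P c) + χ (P a)
count-adjoinˡ {f = f} {g} a f≡g+a P = begin
  count (λ c → f c ∧ P c)              ≡⟨ count-cong (λ c → ∧-comm (f c) (P c)) ⟩
  count (λ c → P c ∧ f c)              ≡⟨ count-adjoinʳ a f≡g+a P ⟩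
  count (λ c → P c ∧ g c) + χ (P a)    ≡⟨ cong (_+ χ (P a)) (count-cong (λ c → ∧-comm (P c) (g c))) ⟩
  count (λ c → g c ∧ P c) + χ (P a)    ∎
  where open ≡-Reasoning

count-multiples : ∀ v l .{{_ : NonZero v}} → count {l * v} (λ c → does (v ∣? toℕ c)) ≡ l
count-multiples v       zero    = refl
count-multiples (suc v) (suc l) = begin
  count {suc l * suc v} (λ c → does (suc v ∣? toℕ c))
    ≡⟨ count-splitAt (suc v) (λ c → does (suc v ∣? toℕ c)) ⟩
  count {suc v} (λ i → does (suc v ∣? toℕ (i ↑ˡ l * suc v))) +
  count {l * suc v} (λ i → does (suc v ∣? toℕ (suc v ↑ʳ i)))
    ≡⟨ cong₂ _+_ (trans (count-cong below) (count-≟ {suc v} fzero))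
                 (trans (count-cong above) (count-multiples (suc v) l)) ⟩
  1 + l ∎
  where
  open ≡-Reasoning
  below : ∀ (i : Fin (suc v)) → does (suc v ∣? toℕ (i ↑ˡ l * suc v)) ≡ does (i Fin.≟ fzero)
  below fzero    = refl
  below (fsuc i) = dec-false (suc v ∣? _) λ v∣i →
    <-irrefl refl (≤-trans (∣⇒≤ v∣i) (subst (_< v) (sym (toℕ-↑ˡ i _)) (toℕ<n i)))
  above : ∀ (i : Fin (l * suc v)) → does (suc v ∣? toℕ (suc v ↑ʳ i)) ≡ does (suc v ∣? toℕ i)
  above i = trans (cong (λ k → does (suc v ∣? k)) (toℕ-↑ʳ (suc v) i))
                  (does-⇔ (mk⇔ (λ v∣v+i → ∣m+n∣m⇒∣n v∣v+i ∣-refl) (∣m∣n⇒∣m+n ∣-refl))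
                          (suc v ∣? _) (suc v ∣? toℕ i))

module ℤₙ (n : ℕ) .{{_ : NonZero n}} where

  0ₙ : Fin n
  0ₙ = ι 0

  toℕ-ι : ∀ m → toℕ (ι {n} m) ≡ m % n
  toℕ-ι m = toℕ-fromℕ< (m%n<n m n)

  ι-cong-% : ∀ {a b} → a % n ≡ b % n → ι {n} a ≡ ι b
  ι-cong-% {a} {b} a≡b = toℕ-injective (trans (toℕ-ι a) (trans a≡b (sym (toℕ-ι b))))

  ι-toℕ : ∀ (i : Fin n) → ι (toℕ i) ≡ i
  ι-toℕ i = toℕ-injective (trans (toℕ-ι (toℕ i)) (m<n⇒m%n≡m (toℕ<n i)))

  ι-+ : ∀ a b → ι {n} a ⊕ ι b ≡ ι (a + b)
  ι-+ a b = begin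
    ι (toℕ (ι {n} a) + toℕ (ι {n} b)) ≡⟨ cong₂ (λ p q → ι (p + q)) (toℕ-ι a) (toℕ-ι b) ⟩
    ι (a % n + b % n)                 ≡⟨ ι-cong-% (sym (%-distribˡ-+ a b n)) ⟩
    ι (a + b)                         ∎
    where open ≡-Reasoning

  ⊕-assoc : ∀ (i j k : Fin n) → (i ⊕ j) ⊕ k ≡ i ⊕ (j ⊕ k)
  ⊕-assoc i j k = begin
    ι (toℕ i + toℕ j) ⊕ k          ≡⟨ cong (ι (toℕ i + toℕ j) ⊕_) (sym (ι-toℕ k)) ⟩
    ι (toℕ i + toℕ j) ⊕ ι (toℕ k)  ≡⟨ ι-+ (toℕ i + toℕ j) (toℕ k) ⟩
    ι (toℕ i + toℕ j + toℕ k)      ≡⟨ cong ι (+-assoc (toℕ i) (toℕ j) (toℕ k)) ⟩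
    ι (toℕ i + (toℕ j + toℕ k))    ≡⟨ ι-+ (toℕ i) (toℕ j + toℕ k) ⟨
    ι (toℕ i) ⊕ ι (toℕ j + toℕ k)  ≡⟨ cong (_⊕ ι (toℕ j + toℕ k)) (ι-toℕ i) ⟩
    i ⊕ (j ⊕ k)                    ∎
    where open ≡-Reasoning

  ⊕-comm : ∀ (i j : Fin n) → i ⊕ j ≡ j ⊕ i
  ⊕-comm i j = cong ι (+-comm (toℕ i) (toℕ j))

  ⊕-identityˡ : ∀ i → 0ₙ ⊕ i ≡ i
  ⊕-identityˡ i = begin
    ι 0 ⊕ i          ≡⟨ cong (ι 0 ⊕_) (sym (ι-toℕ i)) ⟩
    ι 0 ⊕ ι (toℕ i)  ≡⟨ ι-+ 0 (toℕ i) ⟩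
    ι (toℕ i)        ≡⟨ ι-toℕ i ⟩
    i                ∎
    where open ≡-Reasoning

  ⊕-identityʳ : ∀ i → i ⊕ 0ₙ ≡ i
  ⊕-identityʳ i = trans (⊕-comm i 0ₙ) (⊕-identityˡ i)

  ⊖-inverseˡ : ∀ i → (⊖ i) ⊕ i ≡ 0ₙ
  ⊖-inverseˡ i = begin
    ι (n ∸ toℕ i) ⊕ i          ≡⟨ cong (ι (n ∸ toℕ i) ⊕_) (sym (ι-toℕ i)) ⟩
    ι (n ∸ toℕ i) ⊕ ι (toℕ i)  ≡⟨ ι-+ (n ∸ toℕ i) (toℕ i) ⟩
    ι (n ∸ toℕ i + toℕ i)      ≡⟨ cong ι (m∸n+n≡m (<⇒≤ (toℕ<n i))) ⟩
    ι n                        ≡⟨ ι-cong-% (trans (n%n≡0 n) (sym (m<n⇒m%n≡m (>-nonZero⁻¹ n)))) ⟩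
    ι 0                        ∎
    where open ≡-Reasoning

  ⊖-inverseʳ : ∀ i → i ⊕ (⊖ i) ≡ 0ₙ
  ⊖-inverseʳ i = trans (⊕-comm i (⊖ i)) (⊖-inverseˡ i)

  ⊕-isAbelianGroup : IsAbelianGroup _≡_ _⊕_ 0ₙ ⊖_
  ⊕-isAbelianGroup = record
    { isGroup = record
      { isMonoid = record
        { isSemigroup = record
          { isMagma = record { isEquivalence = isEquivalence ; ∙-cong = cong₂ _⊕_ }
          ; assoc   = ⊕-assoc
          }
        ; identity = ⊕-identityˡ , ⊕-identityʳ
        }
      ; inverse = ⊖-inverseˡ , ⊖-inverseʳ
      ; ⁻¹-cong = cong ⊖_
      }
    ; comm = ⊕-comm
    }

  ⊕-abelianGroup : AbelianGroup _ _
  ⊕-abelianGroup = record { isAbelianGroup = ⊕-isAbelianGroup }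

module FiniteGroup {G : Set} {_∙_ : Op₂ G} {ε : G} {_⁻¹ : Op₁ G}
                   (isGroup : IsGroup _≡_ _∙_ ε _⁻¹) {N : ℕ} (enum : Fin N ↔ G) where

  group : Group _ _
  group = record { isGroup = isGroup }

  open IsGroup isGroup using (_\\_; _//_; assoc; inverseˡ)
  open GroupProperties group
    using (\\-leftDividesˡ; \\-leftDividesʳ; //-rightDividesˡ; //-rightDividesʳ;
           ⁻¹-involutive; ⁻¹-anti-homo-∙; inverseʳ-unique)
  open Inverse enum using (strictlyInverseˡ; strictlyInverseʳ) renaming (to to elem; from to index)

  countG : (G → Bool) → ℕ
  countG P = count (P ∘ elem)

  countG-cong : ∀ {P Q : G → Bool} → P ≗ Q → countG P ≡ countG Q
  countG-cong P≗Q = count-cong (P≗Q ∘ elem)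

  countG-bijection : ∀ (φ : G ↔ G) P → countG P ≡ countG (P ∘ Inverse.to φ)
  countG-bijection φ P = trans (count-permute (P ∘ elem) (↔-sym enum ↔-∘ (φ ↔-∘ enum)))
                               (count-cong (λ i → cong P (strictlyInverseˡ (Inverse.to φ (elem i)))))

  countG-translateˡ : ∀ a P → countG P ≡ countG (λ g → P (a ∙ g))
  countG-translateˡ a = countG-bijection (mk↔ₛ′ (a ∙_) (a \\_) (\\-leftDividesˡ a) (\\-leftDividesʳ a))

  countG-translateʳ : ∀ a P → countG P ≡ countG (λ g → P (g ∙ a))
  countG-translateʳ a = countG-bijection (mk↔ₛ′ (_∙ a) (_// a) (//-rightDividesˡ a) (//-rightDividesʳ a))

  countG-⁻¹ : ∀ P → countG P ≡ countG (λ g → P (g ⁻¹))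
  countG-⁻¹ = countG-bijection (mk↔ₛ′ _⁻¹ _⁻¹ ⁻¹-involutive ⁻¹-involutive)

  module Cayley (_≟_ : DecidableEquality G) (S : G → Bool) where

    Cay : Fin N → Fin N → Bool
    Cay u w = S (elem u \\ elem w)

    commonOut : G → ℕ
    commonOut g = countG (λ h → S h ∧ S (h \\ g))

    Cay-outdegree : ∀ u → count (Cay u) ≡ countG S
    Cay-outdegree u = begin
      countG (λ g → S (elem u \\ g))
        ≡⟨ countG-translateˡ (elem u) (λ g → S (elem u \\ g)) ⟩
      countG (λ g → S (elem u \\ (elem u ∙ g)))
        ≡⟨ countG-cong (λ g → cong S (\\-leftDividesʳ (elem u) g)) ⟩
      countG S
        ∎
      where open ≡-Reasoning

    Cay-indegree : ∀ w → count (λ u → Cay u w) ≡ countG S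
    Cay-indegree w = begin
      countG (λ g → S (g \\ elem w))
        ≡⟨ countG-⁻¹ (λ g → S (g \\ elem w)) ⟩
      countG (λ g → S ((g ⁻¹) \\ elem w))
        ≡⟨ countG-cong (λ g → cong (λ h → S (h ∙ elem w)) (⁻¹-involutive g)) ⟩
      countG (λ g → S (g ∙ elem w))
        ≡⟨ countG-translateʳ (elem w) S ⟨
      countG S
        ∎
      where open ≡-Reasoning

    Cay-commonOut : ∀ u w → count (λ z → Cay u z ∧ Cay z w) ≡ commonOut (elem u \\ elem w)
    Cay-commonOut u w = begin
      countG (λ h → S (U \\ h) ∧ S (h \\ W))
        ≡⟨ countG-translateˡ U (λ h → S (U \\ h) ∧ S (h \\ W)) ⟩
      countG (λ h → S (U \\ (U ∙ h)) ∧ S ((U ∙ h) \\ W))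
        ≡⟨ countG-cong (λ h → cong₂ (λ a b → S a ∧ S b) (\\-leftDividesʳ U h) (rearrange h)) ⟩
      countG (λ h → S h ∧ S (h \\ (U \\ W)))
        ∎
      where
      open ≡-Reasoning
      U = elem u
      W = elem w
      rearrange : ∀ h → (U ∙ h) \\ W ≡ h \\ (U \\ W)
      rearrange h = trans (cong (_∙ W) (⁻¹-anti-homo-∙ U h)) (assoc (h ⁻¹) (U ⁻¹) W)

    does-≟-Cay : ∀ u w → does (u Fin.≟ w) ≡ does ((elem u \\ elem w) ≟ ε)
    does-≟-Cay u w = does-⇔ (mk⇔ (λ { refl → inverseˡ (elem u) }) elem-injective)
                            (u Fin.≟ w) ((elem u \\ elem w) ≟ ε)
      where
      elem-injective : elem u \\ elem w ≡ ε → u ≡ w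
      elem-injective u⁻¹w≡ε = begin
        u                    ≡⟨ strictlyInverseʳ u ⟨
        index (elem u)       ≡⟨ cong index (⁻¹-involutive (elem u)) ⟨
        index (elem u ⁻¹ ⁻¹) ≡⟨ cong index (inverseʳ-unique (elem u ⁻¹) (elem w) u⁻¹w≡ε) ⟨
        index (elem w)       ≡⟨ strictlyInverseʳ w ⟩
        w                    ∎
        where open ≡-Reasoning

    Cay-isDSRG : ∀ {k μ λ' t} → countG S ≡ k →
      (∀ g → commonOut g + μ * (χ (does (g ≟ ε)) + χ (S g)) ≡ t * χ (does (g ≟ ε)) + λ' * χ (S g) + μ) →
      IsDSRG N Cay k μ λ' t
    Cay-isDSRG {μ = μ} {λ'} {t} |S|≡k square-at = record
      { rowSum = λ u → trans (Cay-outdegree u) |S|≡k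
      ; colSum = λ w → trans (Cay-indegree w) |S|≡k
      ; square = λ u w → subst (λ δ → count (λ z → Cay u z ∧ Cay z w) + μ * (χ δ + χ (Cay u w))
                                         ≡ t * χ δ + λ' * χ (Cay u w) + μ)
                               (sym (does-≟-Cay u w))
                               (trans (cong (_+ _) (Cay-commonOut u w)) (square-at (elem u \\ elem w)))
      }

IsDSRG-cong : ∀ {N} {A B : Fin N → Fin N → Bool} {k μ λ' t} →
              (∀ u w → A u w ≡ B u w) → IsDSRG N A k μ λ' t → IsDSRG N B k μ λ' t
IsDSRG-cong {A = A} {B} {μ = μ} {λ'} {t} A≗B dsrg = record
  { rowSum = λ u → trans (count-cong (λ w → sym (A≗B u w))) (rowSum u)
  ; colSum = λ w → trans (count-cong (λ u → sym (A≗B u w))) (colSum w)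
  ; square = λ u w → let δ = χ (does (u Fin.≟ w)) in begin
      count (λ z → B u z ∧ B z w) + μ * (δ + χ (B u w))
        ≡⟨ cong₂ (λ p q → p + μ * (δ + χ q))
                 (count-cong (λ z → sym (cong₂ _∧_ (A≗B u z) (A≗B z w)))) (sym (A≗B u w)) ⟩
      count (λ z → A u z ∧ A z w) + μ * (δ + χ (A u w))
        ≡⟨ square u w ⟩
      t * δ + λ' * χ (A u w) + μ
        ≡⟨ cong (λ q → t * δ + λ' * χ q + μ) (A≗B u w) ⟩
      t * δ + λ' * χ (B u w) + μ
        ∎
  }
  where
  open IsDSRG dsrg
  open ≡-Reasoning

module Dihedral (n : ℕ) .{{_ : NonZero n}} where

  open ℤₙ n
  open AbelianGroupProperties ⊕-abelianGroup using (⁻¹-involutive; ⁻¹-∙-comm; ε⁻¹≈ε)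

  e : Dn n
  e = (false , 0ₙ)

  σ : Bool → Fin n → Fin n
  σ r j = if r then ⊖ j else j

  σ-⊕ : ∀ r i j → σ r (i ⊕ j) ≡ σ r i ⊕ σ r j
  σ-⊕ false i j = refl
  σ-⊕ true  i j = sym (⁻¹-∙-comm i j)

  σ-xor : ∀ r s i → σ (r xor s) i ≡ σ r (σ s i)
  σ-xor false s     i = refl
  σ-xor true  false i = refl
  σ-xor true  true  i = sym (⁻¹-involutive i)

  σ-0ₙ : ∀ r → σ r 0ₙ ≡ 0ₙ
  σ-0ₙ false = refl
  σ-0ₙ true  = ε⁻¹≈ε

  ·-assoc : ∀ (g h k : Dn n) → (g · h) · k ≡ g · (h · k)
  ·-assoc (r , i) (s , j) (t , k) = cong₂ _,_ (xor-assoc r s t) (begin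
    (i ⊕ σ r j) ⊕ σ (r xor s) k  ≡⟨ cong ((i ⊕ σ r j) ⊕_) (σ-xor r s k) ⟩
    (i ⊕ σ r j) ⊕ σ r (σ s k)    ≡⟨ ⊕-assoc i (σ r j) (σ r (σ s k)) ⟩
    i ⊕ (σ r j ⊕ σ r (σ s k))    ≡⟨ cong (i ⊕_) (σ-⊕ r j (σ s k)) ⟨
    i ⊕ σ r (j ⊕ σ s k)          ∎)
    where open ≡-Reasoning

  ·-identityˡ : ∀ g → e · g ≡ g
  ·-identityˡ (r , i) = cong (r ,_) (⊕-identityˡ i)

  ·-identityʳ : ∀ g → g · e ≡ g
  ·-identityʳ (r , i) = cong₂ _,_ (xor-identityʳ r) (trans (cong (i ⊕_) (σ-0ₙ r)) (⊕-identityʳ i))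

  inv-inverseˡ : ∀ g → inv g · g ≡ e
  inv-inverseˡ (false , i) = cong (false ,_) (⊖-inverseˡ i)
  inv-inverseˡ (true  , i) = cong (false ,_) (⊖-inverseʳ i)

  inv-inverseʳ : ∀ g → g · inv g ≡ e
  inv-inverseʳ (false , i) = cong (false ,_) (⊖-inverseʳ i)
  inv-inverseʳ (true  , i) = cong (false ,_) (⊖-inverseʳ i)

  ·-isGroup : IsGroup _≡_ _·_ e inv
  ·-isGroup = record
    { isMonoid = record
      { isSemigroup = record
        { isMagma = record { isEquivalence = isEquivalence ; ∙-cong = cong₂ _·_ }
        ; assoc   = ·-assoc
        }
      ; identity = ·-identityˡ , ·-identityʳ
      }
    ; inverse = inv-inverseˡ , inv-inverseʳ
    ; ⁻¹-cong = cong inv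
    }

  _≟_ : DecidableEquality (Dn n)
  _≟_ = ≡-dec Bool._≟_ Fin._≟_

  Dn-enum : Fin (2 * n) ↔ Dn n
  Dn-enum = (2↔Bool ×-↔ ↔-id (Fin n)) ↔-∘ *↔×

  open FiniteGroup ·-isGroup Dn-enum public

  countG-Dn : ∀ P → countG P ≡ count (λ i → P (false , i)) + count (λ i → P (true , i))
  countG-Dn P = begin
    count {2 * n} (P ∘ elem)
      ≡⟨ count-splitAt n (P ∘ elem) ⟩
    count {n} (λ i → P (elem (i ↑ˡ n + 0))) + count {n + 0} (λ j → P (elem (n ↑ʳ j)))
      ≡⟨ cong₂ _+_ (count-cong (λ i → cong P (strictlyInverseˡ (false , i))))
                   (trans (count-splitAt n {0} (λ j → P (elem (n ↑ʳ j))))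
                          (trans (+-identityʳ _)
                                 (count-cong (λ i → cong P (strictlyInverseˡ (true , i)))))) ⟩
    count (λ i → P (false , i)) + count (λ i → P (true , i))
      ∎
    where
    open ≡-Reasoning
    open Inverse Dn-enum using (strictlyInverseˡ) renaming (to to elem)

  -- Dih decodes its vertices with a `with remQuot`, which computes only once splitAt has.
  Dih≗Cay : ∀ X Y g h → Dih X Y g h ≡ Cayley.Cay _≟_ (inS X Y) g h
  Dih≗Cay X Y g h with splitAt n g | splitAt n h
  ... | inj₁ _ | inj₁ _ = refl
  ... | inj₁ _ | inj₂ h′ with splitAt n h′
  ...   | inj₁ _ = refl
  Dih≗Cay X Y g h | inj₂ g′ | inj₁ _ with splitAt n g′
  ...   | inj₁ _ = refl
  Dih≗Cay X Y g h | inj₂ g′ | inj₂ h′ with splitAt n g′ | splitAt n h′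
  ...   | inj₁ _ | inj₁ _ = refl

-- The DSRG equation at g, for s = [g ∈ S], δ = [g = e] and N paths of length 2 from e to g.
square-equation : ∀ {N μ l λ' t s δ} → λ' + 2 ≡ μ + l → t + 1 ≡ μ + l →
                  N + s + (s + δ) ≡ μ + (s + δ) * l →
                  N + μ * (δ + s) ≡ t * δ + λ' * s + μ
square-equation {N} {μ} {l} {λ'} {t} {s} {δ} λ'+2≡μ+l t+1≡μ+l counted =
  +-cancelʳ-≡ (s + (s + δ)) _ _ (begin
    N + μ * (δ + s) + (s + (s + δ))      ≡⟨ shuffle N μ s δ ⟩
    N + s + (s + δ) + μ * (δ + s)        ≡⟨ cong (_+ μ * (δ + s)) counted ⟩
    μ + (s + δ) * l + μ * (δ + s)        ≡⟨ expand μ l s δ ⟩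
    (μ + l) * δ + (μ + l) * s + μ        ≡⟨ cong₂ (λ a b → a * δ + b * s + μ) t+1≡μ+l λ'+2≡μ+l ⟨
    (t + 1) * δ + (λ' + 2) * s + μ       ≡⟨ collect t λ' μ s δ ⟩
    t * δ + λ' * s + μ + (s + (s + δ))   ∎)
  where
  open ≡-Reasoning
  shuffle : ∀ N μ s δ → N + μ * (δ + s) + (s + (s + δ)) ≡ N + s + (s + δ) + μ * (δ + s)
  shuffle = solve-∀
  expand : ∀ μ l s δ → μ + (s + δ) * l + μ * (δ + s) ≡ (μ + l) * δ + (μ + l) * s + μ
  expand = solve-∀
  collect : ∀ t λ' μ s δ → (t + 1) * δ + (λ' + 2) * s + μ ≡ t * δ + λ' * s + μ + (s + (s + δ))
  collect = solve-∀

double-shift : ∀ a k μ l n → a + k ≡ μ + l → 2 * μ ≡ n + l → 2 * a + 2 * k ≡ n + 3 * l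
double-shift a k μ l n a+k≡μ+l 2μ≡n+l = begin
  2 * a + 2 * k    ≡⟨ *-distribˡ-+ 2 a k ⟨
  2 * (a + k)      ≡⟨ cong (2 *_) a+k≡μ+l ⟩
  2 * (μ + l)      ≡⟨ *-distribˡ-+ 2 μ l ⟩
  2 * μ + 2 * l    ≡⟨ cong (_+ 2 * l) 2μ≡n+l ⟩
  n + l + 2 * l    ≡⟨ +-assoc n l (2 * l) ⟩
  n + 3 * l        ∎
  where open ≡-Reasoning

module _ {n : ℕ} .{{_ : NonZero n}} (v : ℕ) (H Y : Subset n)
         (Y≡H+vℤ : ∀ y → (lookup Y y ≡ true) ⇔ (∃[ h ] ∃[ m ] (lookup H h ≡ true × y ≡ ι (toℕ h + v * m))))
         where

  open ℤₙ n

  0∈H⇒0∈Y : lookup H 0ₙ ≡ true → lookup Y 0ₙ ≡ true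
  0∈H⇒0∈Y 0∈H = Equivalence.from (Y≡H+vℤ 0ₙ)
    (0ₙ , 0 , 0∈H , sym (trans (cong (λ k → ι (toℕ 0ₙ + k)) (*-zeroʳ v))
                               (trans (cong ι (+-identityʳ (toℕ 0ₙ))) (ι-toℕ 0ₙ))))

  +-multiple-∈ : ∀ z a → v ∣ toℕ z → lookup Y a ≡ true → lookup Y (z ⊕ a) ≡ true
  +-multiple-∈ z a (divides q toℕz≡qv) a∈Y with Equivalence.to (Y≡H+vℤ a) a∈Y
  ... | h , k , h∈H , a≡h+vk = Equivalence.from (Y≡H+vℤ (z ⊕ a)) (h , k + q , h∈H , (begin
    z ⊕ a                          ≡⟨ cong₂ _⊕_ (trans (sym (ι-toℕ z)) (cong ι toℕz≡qv)) a≡h+vk ⟩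
    ι (q * v) ⊕ ι (toℕ h + v * k)  ≡⟨ ι-+ (q * v) (toℕ h + v * k) ⟩
    ι (q * v + (toℕ h + v * k))    ≡⟨ cong ι (rearrange q v (toℕ h) k) ⟩
    ι (toℕ h + v * (k + q))        ∎))
    where
    open ≡-Reasoning
    rearrange : ∀ q v h k → q * v + (h + v * k) ≡ h + v * (k + q)
    rearrange = solve-∀

module SkewPeriodic (n v l : ℕ) .{{_ : NonZero n}} (v*l≡n : v * l ≡ n) (X Y : Subset n)
  (0∈Y : lookup Y (ι 0) ≡ true)
  (+-multiple-∈Y : ∀ z a → v ∣ toℕ z → lookup Y a ≡ true → lookup Y (z ⊕ a) ≡ true)
  (X≡Y-0 : ∀ c → (lookup X c ≡ true) ⇔ (lookup Y c ≡ true × c ≢ ι 0))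
  (Y⊎-Y : ∀ z → χ (lookup Y z) + χ (lookup Y (⊖ z)) ≡ 1 + χ (does (v ∣? toℕ z)))
  where

  open ℤₙ n
  open AbelianGroupProperties ⊕-abelianGroup
    using (ε⁻¹≈ε; \\-leftDividesʳ; //-rightDividesˡ; ⁻¹-anti-homo-//; x∙y⁻¹≈ε⇒x≈y; x≈y⇒x∙y⁻¹≈ε)
  open FiniteGroup (IsAbelianGroup.isGroup ⊕-isAbelianGroup) (↔-id (Fin n))
    using (countG-⁻¹; countG-translateʳ)

  private
    x y d : Fin n → Bool
    x = lookup X
    y = lookup Y
    d z = does (v ∣? toℕ z)

  instance
    l-nonZero : NonZero l
    l-nonZero = ≢-nonZero λ { refl → ≢-nonZero⁻¹ n (trans (sym v*l≡n) (*-zeroʳ v)) }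

  v∣n : v ∣ n
  v∣n = divides l (trans (sym v*l≡n) (*-comm v l))

  ∣-⊖ : ∀ z → v ∣ toℕ z → v ∣ toℕ (⊖ z)
  ∣-⊖ z v∣z = subst (v ∣_) (sym (toℕ-ι (n ∸ toℕ z))) (%-presˡ-∣ v∣n∸z v∣n)
    where
    v∣n∸z : v ∣ n ∸ toℕ z
    v∣n∸z = ∣m+n∣m⇒∣n (subst (v ∣_) (sym (m+[n∸m]≡n (<⇒≤ (toℕ<n z)))) v∣n) v∣z

  y-periodic : ∀ z a → v ∣ toℕ z → y (z ⊕ a) ≡ y a
  y-periodic z a v∣z = ⇔→≡ (mk⇔ (λ z+a∈Y → subst (λ b → y b ≡ true) (\\-leftDividesʳ z a)
                                                  (+-multiple-∈Y (⊖ z) (z ⊕ a) (∣-⊖ z v∣z) z+a∈Y))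
                                (+-multiple-∈Y z a v∣z))

  y-∧-multiple : ∀ c m → y c ∧ d (c ⊕ (⊖ m)) ≡ y m ∧ d (c ⊕ (⊖ m))
  y-∧-multiple c m with v ∣? toℕ (c ⊕ (⊖ m))
  ... | yes v∣c-m = cong (_∧ true) (trans (cong y (sym (//-rightDividesˡ m c)))
                                          (y-periodic (c ⊕ (⊖ m)) m v∣c-m))
  ... | no  _     = trans (∧-zeroʳ (y c)) (sym (∧-zeroʳ (y m)))

  y≡x+0 : ∀ c → χ (y c) ≡ χ (x c) + χ (does (c Fin.≟ 0ₙ))
  y≡x+0 c with c Fin.≟ 0ₙ
  ... | yes refl rewrite 0∈Y | ¬-not (λ 0∈X → proj₂ (Equivalence.to (X≡Y-0 0ₙ) 0∈X) refl) = refl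
  ... | no  c≢0  = trans (cong χ (⇔→≡ (mk⇔ (λ c∈Y → Equivalence.from (X≡Y-0 c) (c∈Y , c≢0))
                                          (proj₁ ∘ Equivalence.to (X≡Y-0 c)))))
                         (sym (+-identityʳ _))

  y∘φ≡x∘φ+a : ∀ (φ : Fin n → Fin n) a → (∀ c → φ c ≡ 0ₙ ⇔ c ≡ a) →
              ∀ c → χ (y (φ c)) ≡ χ (x (φ c)) + χ (does (c Fin.≟ a))
  y∘φ≡x∘φ+a φ a φc≡0⇔c≡a c = trans (y≡x+0 (φ c)) (cong (λ b → χ (x (φ c)) + χ b)
                                     (does-⇔ (φc≡0⇔c≡a c) (φ c Fin.≟ 0ₙ) (c Fin.≟ a)))

  count-multiples-ℤₙ : count d ≡ l
  count-multiples-ℤₙ = subst (λ N → count {N} (λ c → does (v ∣? toℕ c)) ≡ l)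
                             (trans (*-comm l v) v*l≡n) (count-multiples v l)
    where
    instance
      v-nonZero : NonZero v
      v-nonZero = ≢-nonZero λ { refl → ≢-nonZero⁻¹ n (sym v*l≡n) }

  count-y+count-y : count y + count y ≡ n + l
  count-y+count-y = begin
    count y + count y              ≡⟨ cong (count y +_) (countG-⁻¹ y) ⟩
    count y + count (λ z → y (⊖ z)) ≡⟨ count-+-cong Y⊎-Y ⟩
    count {n} (λ _ → true) + count d ≡⟨ cong₂ _+_ (count-true n) count-multiples-ℤₙ ⟩
    n + l                          ∎
    where open ≡-Reasoning

  count-y≡suc-count-x : count y ≡ suc (count x)
  count-y≡suc-count-x = begin
    count y                                    ≡⟨ count-+ y≡x+0 ⟩
    count x + count (λ c → does (c Fin.≟ 0ₙ))  ≡⟨ cong (count x +_) (count-≟ 0ₙ) ⟩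
    count x + 1                                ≡⟨ +-comm (count x) 1 ⟩
    suc (count x)                              ∎
    where open ≡-Reasoning

  sum-and-difference-counts : ∀ m → count (λ c → y c ∧ y ((⊖ c) ⊕ m)) + count (λ c → y c ∧ y (c ⊕ (⊖ m)))
                                    ≡ count y + χ (y m) * l
  sum-and-difference-counts m = begin
    count (λ c → y c ∧ y ((⊖ c) ⊕ m)) + count (λ c → y c ∧ y (c ⊕ (⊖ m)))
      ≡⟨ count-+-cong pointwise ⟩
    count y + count (λ c → y m ∧ d (c ⊕ (⊖ m)))
      ≡⟨ cong (count y +_) (count-const-∧ (y m) (λ c → d (c ⊕ (⊖ m)))) ⟩
    count y + χ (y m) * count (λ c → d (c ⊕ (⊖ m)))
      ≡⟨ cong (λ k → count y + χ (y m) * k)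
              (trans (sym (countG-translateʳ (⊖ m) d)) count-multiples-ℤₙ) ⟩
    count y + χ (y m) * l
      ∎
    where
    open ≡-Reasoning
    pointwise : ∀ c → χ (y c ∧ y ((⊖ c) ⊕ m)) + χ (y c ∧ y (c ⊕ (⊖ m)))
                      ≡ χ (y c) + χ (y m ∧ d (c ⊕ (⊖ m)))
    pointwise c = begin
      χ (y c ∧ y ((⊖ c) ⊕ m)) + χ (y c ∧ y z)
        ≡⟨ cong (λ w → χ (y c ∧ y w) + χ (y c ∧ y z)) ⊖z≡m-c ⟨
      χ (y c ∧ y (⊖ z)) + χ (y c ∧ y z)
        ≡⟨ cong₂ _+_ (χ-∧ (y c) (y (⊖ z))) (χ-∧ (y c) (y z)) ⟩
      χ (y c) * χ (y (⊖ z)) + χ (y c) * χ (y z)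
        ≡⟨ *-distribˡ-+ (χ (y c)) _ _ ⟨
      χ (y c) * (χ (y (⊖ z)) + χ (y z))
        ≡⟨ cong (χ (y c) *_) (trans (+-comm (χ (y (⊖ z))) (χ (y z))) (Y⊎-Y z)) ⟩
      χ (y c) * (1 + χ (d z))
        ≡⟨ *-distribˡ-+ (χ (y c)) 1 (χ (d z)) ⟩
      χ (y c) * 1 + χ (y c) * χ (d z)
        ≡⟨ cong₂ _+_ (*-identityʳ (χ (y c))) (sym (χ-∧ (y c) (d z))) ⟩
      χ (y c) + χ (y c ∧ d z)
        ≡⟨ cong (λ b → χ (y c) + χ b) (y-∧-multiple c m) ⟩
      χ (y c) + χ (y m ∧ d z)
        ∎
      where
      z = c ⊕ (⊖ m)
      ⊖z≡m-c : ⊖ z ≡ (⊖ c) ⊕ m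
      ⊖z≡m-c = trans (⁻¹-anti-homo-// c m) (⊕-comm m (⊖ c))

  ⊖0ₙ⊕m≡m : ∀ m → (⊖ 0ₙ) ⊕ m ≡ m
  ⊖0ₙ⊕m≡m m = trans (cong (_⊕ m) ε⁻¹≈ε) (⊕-identityˡ m)

  m-c≡0⇔c≡m : ∀ m c → (⊖ c) ⊕ m ≡ 0ₙ ⇔ c ≡ m
  m-c≡0⇔c≡m m c = mk⇔ (λ m-c≡0 → sym (x∙y⁻¹≈ε⇒x≈y m c (trans (⊕-comm m (⊖ c)) m-c≡0)))
                      (λ { refl → ⊖-inverseˡ c })

  c-m≡0⇔c≡m : ∀ m c → c ⊕ (⊖ m) ≡ 0ₙ ⇔ c ≡ m
  c-m≡0⇔c≡m m c = mk⇔ (x∙y⁻¹≈ε⇒x≈y c m) x≈y⇒x∙y⁻¹≈ε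

  yy≡xy+y : ∀ m → count (λ c → y c ∧ y ((⊖ c) ⊕ m)) ≡ count (λ c → x c ∧ y ((⊖ c) ⊕ m)) + χ (y m)
  yy≡xy+y m = trans (count-adjoinˡ 0ₙ y≡x+0 (λ c → y ((⊖ c) ⊕ m)))
                    (cong (λ b → count (λ c → x c ∧ y ((⊖ c) ⊕ m)) + χ (y b)) (⊖0ₙ⊕m≡m m))

  xy≡xx+x : ∀ m → count (λ c → x c ∧ y ((⊖ c) ⊕ m)) ≡ count (λ c → x c ∧ x ((⊖ c) ⊕ m)) + χ (x m)
  xy≡xx+x m = count-adjoinʳ m (y∘φ≡x∘φ+a (λ c → (⊖ c) ⊕ m) m (m-c≡0⇔c≡m m)) x

  yy≡yx+y : ∀ m → count (λ c → y c ∧ y (c ⊕ (⊖ m))) ≡ count (λ c → y c ∧ x (c ⊕ (⊖ m))) + χ (y m)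
  yy≡yx+y m = count-adjoinʳ m (y∘φ≡x∘φ+a (λ c → c ⊕ (⊖ m)) m (c-m≡0⇔c≡m m)) y

  rotation-count : ∀ m → count (λ c → x c ∧ x ((⊖ c) ⊕ m)) + count (λ c → y c ∧ y (c ⊕ (⊖ m)))
                         + χ (x m) + χ (y m) ≡ count y + χ (y m) * l
  rotation-count m = begin
    xx + yy′ + χ (x m) + χ (y m)   ≡⟨ shuffle xx yy′ (χ (x m)) (χ (y m)) ⟩
    xx + χ (x m) + χ (y m) + yy′   ≡⟨ cong (λ k → k + χ (y m) + yy′) (xy≡xx+x m) ⟨
    xy + χ (y m) + yy′             ≡⟨ cong (_+ yy′) (yy≡xy+y m) ⟨
    yy + yy′                       ≡⟨ sum-and-difference-counts m ⟩
    count y + χ (y m) * l          ∎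
    where
    open ≡-Reasoning
    xx = count (λ c → x c ∧ x ((⊖ c) ⊕ m))
    xy = count (λ c → x c ∧ y ((⊖ c) ⊕ m))
    yy = count (λ c → y c ∧ y ((⊖ c) ⊕ m))
    yy′ = count (λ c → y c ∧ y (c ⊕ (⊖ m)))
    shuffle : ∀ a b c d → a + b + c + d ≡ a + c + d + b
    shuffle = solve-∀

  reflection-count : ∀ m → count (λ c → x c ∧ y ((⊖ c) ⊕ m)) + count (λ c → y c ∧ x (c ⊕ (⊖ m)))
                           + χ (y m) + χ (y m) ≡ count y + χ (y m) * l
  reflection-count m = begin
    xy + yx′ + χ (y m) + χ (y m)     ≡⟨ shuffle xy yx′ (χ (y m)) (χ (y m)) ⟩
    (xy + χ (y m)) + (yx′ + χ (y m)) ≡⟨ cong₂ _+_ (yy≡xy+y m) (yy≡yx+y m) ⟨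
    yy + yy′                         ≡⟨ sum-and-difference-counts m ⟩
    count y + χ (y m) * l            ∎
    where
    open ≡-Reasoning
    xy = count (λ c → x c ∧ y ((⊖ c) ⊕ m))
    yx′ = count (λ c → y c ∧ x (c ⊕ (⊖ m)))
    yy = count (λ c → y c ∧ y ((⊖ c) ⊕ m))
    yy′ = count (λ c → y c ∧ y (c ⊕ (⊖ m)))
    shuffle : ∀ a b c d → a + b + c + d ≡ (a + c) + (b + d)
    shuffle = solve-∀

  open Dihedral n using (e; _≟_; countG; countG-Dn; Dih≗Cay; module Cayley)
  open Cayley _≟_ (inS X Y) using (commonOut; Cay-isDSRG)

  μ λ' t : ℕ
  μ = count y
  λ' = count x + pred l
  t = count y + pred l

  2μ≡n+l : 2 * μ ≡ n + l
  2μ≡n+l = trans (cong (μ +_) (+-identityʳ μ)) count-y+count-y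

  λ'+2≡μ+l : λ' + 2 ≡ μ + l
  λ'+2≡μ+l = trans (shift (count x) (pred l)) (cong₂ _+_ (sym count-y≡suc-count-x) (suc-pred l))
    where
    shift : ∀ a b → a + b + 2 ≡ suc a + suc b
    shift = solve-∀

  t+1≡μ+l : t + 1 ≡ μ + l
  t+1≡μ+l = trans (+-comm t 1) (trans (sym (+-suc μ (pred l))) (cong (μ +_) (suc-pred l)))

  |S|≡k : countG (inS X Y) ≡ n + l ∸ 1
  |S|≡k = trans (countG-Dn (inS X Y))
                (cong (_∸ 1) (trans (cong (_+ μ) (sym count-y≡suc-count-x)) count-y+count-y))

  square-at : ∀ g → commonOut g + μ * (χ (does (g ≟ e)) + χ (inS X Y g))
                    ≡ t * χ (does (g ≟ e)) + λ' * χ (inS X Y g) + μ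
  square-at (false , m) = square-equation λ'+2≡μ+l t+1≡μ+l (begin
    commonOut (false , m) + χ (x m) + (χ (x m) + χ (does (m Fin.≟ 0ₙ)))
      ≡⟨ cong₂ (λ N b → N + χ (x m) + b) (countG-Dn (λ h → inS X Y h ∧ inS X Y (inv h · (false , m))))
                                         (sym (y≡x+0 m)) ⟩
    count (λ c → x c ∧ x ((⊖ c) ⊕ m)) + count (λ c → y c ∧ y (c ⊕ (⊖ m))) + χ (x m) + χ (y m)
      ≡⟨ rotation-count m ⟩
    μ + χ (y m) * l
      ≡⟨ cong (λ b → μ + b * l) (y≡x+0 m) ⟩
    μ + (χ (x m) + χ (does (m Fin.≟ 0ₙ))) * l ∎)
    where open ≡-Reasoning
  square-at (true , m) = square-equation λ'+2≡μ+l t+1≡μ+l (begin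
    commonOut (true , m) + χ (y m) + (χ (y m) + 0)
      ≡⟨ cong₂ (λ N b → N + χ (y m) + b) (countG-Dn (λ h → inS X Y h ∧ inS X Y (inv h · (true , m))))
                                         (+-identityʳ (χ (y m))) ⟩
    count (λ c → x c ∧ y ((⊖ c) ⊕ m)) + count (λ c → y c ∧ x (c ⊕ (⊖ m))) + χ (y m) + χ (y m)
      ≡⟨ reflection-count m ⟩
    μ + χ (y m) * l
      ≡⟨ cong (λ b → μ + b * l) (+-identityʳ (χ (y m))) ⟨
    μ + (χ (y m) + 0) * l ∎)
    where open ≡-Reasoning

  Dih-isDSRG : IsDSRG (2 * n) (Dih X Y) (n + l ∸ 1) μ λ' t
  Dih-isDSRG = IsDSRG-cong (λ u w → sym (Dih≗Cay X Y u w)) (Cay-isDSRG |S|≡k square-at)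

mainTheorem13 :
    (n v l : ℕ) .{{_ : NonZero n}} →
    ¬ (2 ∣ v) → v * l ≡ n →
    (H X Y : Subset n) →
    (∀ h → lookup H h ≡ true → toℕ h < v) →
    lookup H (ι 0) ≡ true →
    (∀ y → (lookup Y y ≡ true) ⇔ (∃[ h ] ∃[ m ] (lookup H h ≡ true × y ≡ ι (toℕ h + v * m)))) →
    (∀ y → (lookup X y ≡ true) ⇔ (lookup Y y ≡ true × y ≢ ι 0)) →
    (∀ z → χ (lookup Y z) + χ (lookup Y (⊖ z)) ≡ 1 + χ (does (v ∣? toℕ z))) →
    Σ ℕ (λ μ → Σ ℕ (λ λ' → Σ ℕ (λ t →
      (2 * μ ≡ n + l) × (2 * λ' + 4 ≡ n + 3 * l) × (2 * t + 2 ≡ n + 3 * l) ×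
      IsDSRG (2 * n) (Dih X Y) (n + l ∸ 1) μ λ' t)))
mainTheorem13 n v l _ v*l≡n H X Y _ 0∈H Y≡H+vℤ X≡Y-0 Y⊎-Y =
  μ , λ' , t , 2μ≡n+l ,
  double-shift λ' 2 μ l n λ'+2≡μ+l 2μ≡n+l ,
  double-shift t 1 μ l n t+1≡μ+l 2μ≡n+l ,
  Dih-isDSRG
  where
  open SkewPeriodic n v l v*l≡n X Y (0∈H⇒0∈Y v H Y Y≡H+vℤ 0∈H) (+-multiple-∈ v H Y Y≡H+vℤ) X≡Y-0 Y⊎-Y
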